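{- For every $a, b \in \Lambda_{\mathrm{dB}}$ and every $n \in \mathbb{N}_{>0}$, $$a\{\!\{n \leftarrow b\}\!\} \;=\; \big(\mathrm{SW}_1^{\,n-1}(a)\big)\big[\mathrm{INC}^{\,n-1}(b)\big].$$
   Context: $\Lambda_{\mathrm{dB}}$ is the set of de Bruijn terms given by $a ::= n \mid a\,a \mid \lambda a$ with $n \in \mathbb{N}_{>0}$. Updating: for $k\in\mathbb{N}$, $i\in\mathbb{N}_{>0}$, $U^i_k(n)=n$ if $n\le k$ and $U^i_k(n)=n+i-1$ if $n>k$; $U^i_k(a\,b)=U^i_k(a)\,U^i_k(b)$; $U^i_k(\lambda a)=\lambda U^i_{k+1}(a)$. de Bruijn meta-substitution: $m\{\!\{n\leftarrow c\}\!\}$ equals $m$ if $m<n$, $U^n_0(c)$ if $m=n$, and $m-1$ if $m>n$; $(a\,b)\{\!\{n\leftarrow c\}\!\}=a\{\!\{n\leftarrow c\}\!\}\,b\{\!\{n\leftarrow c\}\!\}$; $(\lambda a)\{\!\{n\leftarrow c\}\!\}=\lambda\,(a\{\!\{n+1\leftarrow c\}\!\})$. Increment: for $i\in\mathbb{N}$, $\mathrm{inc}_i(n)=n$ if $n\le i$ and $n+1$ if $n>i$; $\mathrm{inc}_i(a\,b)=\mathrm{inc}_i(a)\,\mathrm{inc}_i(b)$; $\mathrm{inc}_i(\lambda a)=\lambda\,\mathrm{inc}_{i+1}(a)$. Swap: for $i\in\mathbb{N}_{>0}$, $\mathrm{sw}_i(n)=n$ if $n<i$ or $n>i+1$, $\mathrm{sw}_i(i)=i+1$,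 $\mathrm{sw}_i(i+1)=i$; $\mathrm{sw}_i(a\,b)=\mathrm{sw}_i(a)\,\mathrm{sw}_i(b)$; $\mathrm{sw}_i(\lambda a)=\lambda\,\mathrm{sw}_{i+1}(a)$. $\lambda r$ meta-substitution $a[c]$: $1[c]=c$, $n[c]=n-1$ for $n>1$; $(a\,b)[c]=a[c]\,b[c]$; $(\lambda a)[c]=\lambda\big(\mathrm{sw}_1(a)[\mathrm{inc}_0(c)]\big)$. Stacked swap: for $i\in\mathbb{N}_{>0}$, $j\in\mathbb{N}$, $\mathrm{SW}_i^0(a)=a$ and $\mathrm{SW}_i^j(a)=\mathrm{SW}_i^{j-1}(\mathrm{sw}_{i+j-1}(a))$ for $j>0$ (so $\mathrm{SW}_i^j(a)=\mathrm{sw}_i(\mathrm{sw}_{i+1}(\cdots\mathrm{sw}_{i+j-1}(a)\cdots))$). Stacked increment: for $i\in\mathbb{N}$, $\mathrm{INC}^0(a)=a$ and $\mathrm{INC}^i(a)=\mathrm{INC}^{i-1}(\mathrm{inc}_0(a))$ for $i>0$ (i.e. $i$ applications of $\mathrm{inc}_0$). -}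

module Defs where

open import Data.Nat using (ℕ; zero; suc; _+_; _∸_; _<ᵇ_; _≡ᵇ_; NonZero; nonZero)
open import Data.Bool using (Bool; true; false; if_then_else_)

data Λ : Set where
  var : (n : ℕ) → .{{_ : NonZero n}} → Λ
  app : Λ → Λ → Λ
  lam : Λ → Λ

var⁺ : ℕ → Λ
var⁺ k = var (suc k)

U : (i : ℕ) → .{{_ : NonZero i}} → ℕ → Λ → Λ
U i k (var (suc m)) with suc m Data.Nat.≤ᵇ k
... | true  = var (suc m)
... | false = var⁺ (m + i ∸ 1)   -- index (suc m) + i ∸ 1 = m + i
U i k (app a b) = app (U i k a) (U i k b)
U i k (lam a)   = lam (U i (suc k) a)

infix 30 _⦃⦃_←_⦄⦄
_⦃⦃_←_⦄⦄ : Λ → (n : ℕ) → .{{_ : NonZero n}} → Λ → Λ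
(var (suc m)) ⦃⦃ n ← c ⦄⦄ with suc m <ᵇ n | suc m ≡ᵇ n
... | true  | _     = var (suc m)
... | false | true  = U n 0 c
... | false | false = var⁺ (m ∸ 1)   -- index (suc m) ∸ 1 = m, which is > 0 here
(app a b) ⦃⦃ n ← c ⦄⦄ = app (a ⦃⦃ n ← c ⦄⦄) (b ⦃⦃ n ← c ⦄⦄)
(lam a)   ⦃⦃ n ← c ⦄⦄ = lam (a ⦃⦃ suc n ← c ⦄⦄)

inc : ℕ → Λ → Λ
inc i (var (suc m)) with suc m Data.Nat.≤ᵇ i
... | true  = var (suc m)
... | false = var (suc (suc m))
inc i (app a b) = app (inc i a) (inc i b)
inc i (lam a)   = lam (inc (suc i) a)

sw : (i : ℕ) → .{{_ : NonZero i}} → Λ → Λ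
sw i (var (suc m)) with suc m ≡ᵇ i | suc m ≡ᵇ suc i
... | true  | _     = var (suc i)
... | false | true  = var i
... | false | false = var (suc m)
sw i (app a b) = app (sw i a) (sw i b)
sw i (lam a)   = lam (sw (suc i) a)

-- λr meta-substitution a[c]
-- Since the recursive call is on sw_1(a) (same size as a, not a structural
-- subterm), we define it by recursion on a fuel bound ≥ size, and use
-- fuel = size a.  Because sw preserves size, the fuel never runs out, so
-- _[_] satisfies exactly the defining equations of the paper.
size : Λ → ℕ
size (var n)   = 1
size (app a b) = suc (size a + size b)
size (lam a)   = suc (size a)

subst-fuel : ℕ → Λ → Λ → Λ
subst-fuel zero    a c = a   -- unreachable when fuel ≥ size a
subst-fuel (suc f) (var 1) c = c
subst-fuel (suc f) (var (suc (suc m))) c = var (suc m)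
subst-fuel (suc f) (app a b) c = app (subst-fuel f a c) (subst-fuel f b c)
subst-fuel (suc f) (lam a) c = lam (subst-fuel f (sw 1 a) (inc 0 c))

_[_] : Λ → Λ → Λ
a [ c ] = subst-fuel (size a) a c

SW : (i : ℕ) → .{{_ : NonZero i}} → ℕ → Λ → Λ
SW i zero    a = a
SW (suc i) (suc j) a = SW (suc i) j (sw (suc i + j) a)

INC : ℕ → Λ → Λ
INC zero    a = a
INC (suc i) a = INC i (inc 0 a)

-- Under a binder de Bruijn substitution moves from
-- index n to n + 1, while λr-substitution applies sw₁ and increments the
-- argument; since SW₁ⁿ = sw₁ ∘ SW₂ⁿ⁻¹ and SW commutes with λ by raising its
-- base index, the inductive hypothesis at n + 1 is exactly what is needed.
-- At a variable, SW₁ⁿ⁻¹ is the cycle sending n to 1 and k to k + 1 for k < n,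
-- fixing k > n; then λr-substitution sends 1 to INCⁿ⁻¹ b = Uⁿ₀ b and
-- decrements every other index, as de Bruijn substitution does.
module Submission where

open import Defs
open import Data.Nat using (ℕ; zero; suc; _+_; _∸_; NonZero; _<_; _≤_; _≤ᵇ_; _<ᵇ_; _≡ᵇ_; z≤n; s≤s)
open import Data.Nat.Properties
open import Data.Bool using (true; false; T)
open import Relation.Nullary using (¬_; yes; no; contradiction)
open import Function using (_∘_)
open import Relation.Nullary.Decidable using (dec-true; dec-false)
open import Relation.Binary using (tri<; tri≈; tri>)
open import Relation.Binary.PropositionalEquality hiding ([_])
open ≡-Reasoning

private
  variable
    m n i : ℕ

≡ᵇ-true : m ≡ n → (m ≡ᵇ n) ≡ true
≡ᵇ-true {m} {n} = dec-true (m ≟ n)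

≡ᵇ-false : m ≢ n → (m ≡ᵇ n) ≡ false
≡ᵇ-false {m} {n} = dec-false (m ≟ n)

<ᵇ-true : m < n → (m <ᵇ n) ≡ true
<ᵇ-true {m} {n} = dec-true (m <? n)

<ᵇ-false : ¬ m < n → (m <ᵇ n) ≡ false
<ᵇ-false {m} {n} = dec-false (m <? n)

≤ᵇ-false : ¬ m ≤ n → (m ≤ᵇ n) ≡ false
≤ᵇ-false {m} {n} = dec-false (m ≤? n)

sw-var-left : ∀ i → sw (suc i) (var⁺ i) ≡ var⁺ (suc i)
sw-var-left i rewrite ≡ᵇ-true (refl {x = i}) = refl

sw-var-right : ∀ i → sw (suc i) (var⁺ (suc i)) ≡ var⁺ i
sw-var-right i rewrite ≡ᵇ-false (1+n≢n {i}) | ≡ᵇ-true (refl {x = i}) = refl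

sw-var-other : m ≢ i → m ≢ suc i → sw (suc i) (var⁺ m) ≡ var⁺ m
sw-var-other m≢i m≢1+i rewrite ≡ᵇ-false m≢i | ≡ᵇ-false m≢1+i = refl

-- SW (suc i) j is the cycle var⁺ (i + j) ↦ var⁺ i ↦ var⁺ (suc i) ↦ ⋯ ↦ var⁺ (i + j).
SW-var-above : ∀ i j → i + j < m → SW (suc i) j (var⁺ m) ≡ var⁺ m
SW-var-above i zero    _ = refl
SW-var-above {m} i (suc j) i+1+j<m rewrite +-suc i j
  | sw-var-other {m} {i + j} (<⇒≢ (<-trans (n<1+n _) i+1+j<m) ∘ sym) (<⇒≢ i+1+j<m ∘ sym)
  = SW-var-above i j (<-trans (n<1+n _) i+1+j<m)

SW-var-last : ∀ i j → SW (suc i) j (var⁺ (i + j)) ≡ var⁺ i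
SW-var-last i zero    rewrite +-identityʳ i = refl
SW-var-last i (suc j) rewrite +-suc i j | sw-var-right (i + j) = SW-var-last i j

SW-var-inside : ∀ i j → i ≤ m → m < i + j → SW (suc i) j (var⁺ m) ≡ var⁺ (suc m)
SW-var-inside i zero i≤m m<i+0 = contradiction (≤-<-trans i≤m m<i+0) (<-irrefl (sym (+-identityʳ i)))
SW-var-inside {m} i (suc j) i≤m m<i+1+j rewrite +-suc i j with m ≟ i + j
... | yes refl rewrite sw-var-left (i + j) = SW-var-above i j (n<1+n _)
... | no m≢i+j rewrite sw-var-other m≢i+j (<⇒≢ m<i+1+j)
  = SW-var-inside i j i≤m (≤∧≢⇒< (≤-pred m<i+1+j) m≢i+j)

SW-app : ∀ i j a b → SW (suc i) j (app a b) ≡ app (SW (suc i) j a) (SW (suc i) j b)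
SW-app i zero    a b = refl
SW-app i (suc j) a b = SW-app i j _ _

SW-lam : ∀ i j a → SW (suc i) j (lam a) ≡ lam (SW (suc (suc i)) j a)
SW-lam i zero    a = refl
SW-lam i (suc j) a = SW-lam i j _

SW-suc : ∀ i j a → SW (suc i) (suc j) a ≡ sw (suc i) (SW (suc (suc i)) j a)
SW-suc i zero    a = cong (λ k → sw (suc k) a) (+-identityʳ i)
SW-suc i (suc j) a = begin
  SW (suc i) (suc j) (sw (suc i + suc j) a)                ≡⟨ SW-suc i j _ ⟩
  sw (suc i) (SW (suc (suc i)) j (sw (suc i + suc j) a))   ≡⟨ cong (λ k → sw (suc i) (SW (suc (suc i)) j (sw (suc k) a))) (+-suc i j) ⟩
  sw (suc i) (SW (suc (suc i)) j (sw (suc (suc i) + j) a)) ∎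

size-sw : ∀ i a → size (sw (suc i) a) ≡ size a
size-sw i (var (suc m)) with suc m ≡ᵇ suc i | suc m ≡ᵇ suc (suc i)
... | true  | _     = refl
... | false | true  = refl
... | false | false = refl
size-sw i (app a b) = cong₂ (λ x y → suc (x + y)) (size-sw i a) (size-sw i b)
size-sw i (lam a)   = cong suc (size-sw (suc i) a)

subst-fuel-irrelevant : ∀ {f g} a c → size a ≤ f → size a ≤ g → subst-fuel f a c ≡ subst-fuel g a c
subst-fuel-irrelevant (var 1)             c (s≤s _) (s≤s _) = refl
subst-fuel-irrelevant (var (suc (suc m))) c (s≤s _) (s≤s _) = refl
subst-fuel-irrelevant (app a b) c (s≤s p) (s≤s q) = cong₂ app
  (subst-fuel-irrelevant a c (m+n≤o⇒m≤o _ p) (m+n≤o⇒m≤o _ q))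
  (subst-fuel-irrelevant b c (m+n≤o⇒n≤o _ p) (m+n≤o⇒n≤o _ q))
subst-fuel-irrelevant (lam a) c (s≤s p) (s≤s q) = cong lam
  (subst-fuel-irrelevant (sw 1 a) (inc 0 c) (≤-trans (≤-reflexive (size-sw 0 a)) p) (≤-trans (≤-reflexive (size-sw 0 a)) q))

app-[] : ∀ a b c → (app a b) [ c ] ≡ app (a [ c ]) (b [ c ])
app-[] a b c = cong₂ app
  (subst-fuel-irrelevant a c (m≤m+n _ _) ≤-refl)
  (subst-fuel-irrelevant b c (m≤n+m _ _) ≤-refl)

lam-[] : ∀ a c → (lam a) [ c ] ≡ lam ((sw 1 a) [ inc 0 c ])
lam-[] a c = cong lam (subst-fuel-irrelevant (sw 1 a) (inc 0 c) (≤-reflexive (size-sw 0 a)) ≤-refl)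

INC-suc : ∀ n b → INC (suc n) b ≡ inc 0 (INC n b)
INC-suc zero    b = refl
INC-suc (suc n) b = INC-suc n (inc 0 b)

U-identity : ∀ k b → U 1 k b ≡ b
U-identity k (var (suc m)) with suc m ≤ᵇ k
... | true  = refl
... | false = cong var⁺ (m+n∸n≡m m 1)
U-identity k (app a b) = cong₂ app (U-identity k a) (U-identity k b)
U-identity k (lam a)   = cong lam (U-identity (suc k) a)

U-suc : ∀ i k b → U (suc (suc i)) k b ≡ inc k (U (suc i) k b)
U-suc i k (var (suc m)) with suc m ≤ᵇ k in m<k
... | true rewrite m<k = refl
... | false rewrite +-suc m (suc i) | +-suc m i
  | ≤ᵇ-false {suc (m + i)} {k} (λ m+i<k → subst T m<k (≤⇒≤ᵇ (≤-trans (s≤s (m≤m+n m i)) m+i<k)))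
  = refl
U-suc i k (app a b) = cong₂ app (U-suc i k a) (U-suc i k b)
U-suc i k (lam a)   = cong lam (U-suc i (suc k) a)

U-zero≡INC : ∀ n b → U (suc n) 0 b ≡ INC n b
U-zero≡INC zero    b = U-identity 0 b
U-zero≡INC (suc n) b = begin
  U (suc (suc n)) 0 b  ≡⟨ U-suc n 0 b ⟩
  inc 0 (U (suc n) 0 b) ≡⟨ cong (inc 0) (U-zero≡INC n b) ⟩
  inc 0 (INC n b)       ≡⟨ INC-suc n b ⟨
  INC (suc n) b         ∎

dB-subst-as-λr-var : ∀ m n b → (var⁺ m) ⦃⦃ suc n ← b ⦄⦄ ≡ (SW 1 n (var⁺ m)) [ INC n b ]
dB-subst-as-λr-var m n b with <-cmp m n
... | tri< m<n _ _ rewrite <ᵇ-true m<n | SW-var-inside 0 n z≤n m<n = refl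
... | tri≈ _ refl _ rewrite <ᵇ-false (<-irrefl (refl {x = m})) | ≡ᵇ-true (refl {x = m}) | SW-var-last 0 m
  = U-zero≡INC m b
dB-subst-as-λr-var (suc m) n b | tri> _ m≢n n<m
  rewrite <ᵇ-false (<⇒≯ n<m) | ≡ᵇ-false m≢n | SW-var-above 0 n n<m = refl

dB-subst-as-λr : ∀ a b n → a ⦃⦃ suc n ← b ⦄⦄ ≡ (SW 1 n a) [ INC n b ]
dB-subst-as-λr (var (suc m)) b n = dB-subst-as-λr-var m n b
dB-subst-as-λr (app a a′) b n = begin
  app (a ⦃⦃ suc n ← b ⦄⦄) (a′ ⦃⦃ suc n ← b ⦄⦄)
    ≡⟨ cong₂ app (dB-subst-as-λr a b n) (dB-subst-as-λr a′ b n) ⟩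
  app ((SW 1 n a) [ INC n b ]) ((SW 1 n a′) [ INC n b ])
    ≡⟨ app-[] (SW 1 n a) (SW 1 n a′) (INC n b) ⟨
  (app (SW 1 n a) (SW 1 n a′)) [ INC n b ]
    ≡⟨ cong _[ INC n b ] (SW-app 0 n a a′) ⟨
  (SW 1 n (app a a′)) [ INC n b ] ∎
dB-subst-as-λr (lam a) b n = begin
  lam (a ⦃⦃ suc (suc n) ← b ⦄⦄)
    ≡⟨ cong lam (dB-subst-as-λr a b (suc n)) ⟩
  lam ((SW 1 (suc n) a) [ INC (suc n) b ])
    ≡⟨ cong₂ (λ x y → lam (x [ y ])) (SW-suc 0 n a) (INC-suc n b) ⟩
  lam ((sw 1 (SW 2 n a)) [ inc 0 (INC n b) ])
    ≡⟨ lam-[] (SW 2 n a) (INC n b) ⟨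
  (lam (SW 2 n a)) [ INC n b ]
    ≡⟨ cong _[ INC n b ] (SW-lam 0 n a) ⟨
  (SW 1 n (lam a)) [ INC n b ] ∎

theorem1 : (a b : Λ) (n : ℕ) .{{_ : NonZero n}} → a ⦃⦃ n ← b ⦄⦄ ≡ (SW 1 (n ∸ 1) a) [ INC (n ∸ 1) b ]
theorem1 a b (suc n) = dB-subst-as-λr a b n
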